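{- For every integer $t\geq 1$ and every $\varepsilon>0$, there is a finite graph $G_{t,\varepsilon}$ with maximum degree $3$ such that player $\mathbf{B}$ has a strategy in the Voronoi game on $G_{t,\varepsilon}$ guaranteeing that, whatever $\mathbf{A}$ plays, after each of the rounds $k=1,\dots,t$ player $\mathbf{B}$ controls at least $(1-\varepsilon)|V(G_{t,\varepsilon})|$ vertices, i.e. at least that many vertices are strictly closer to the set of vertices claimed by $\mathbf{B}$ in the first $k$ rounds than to the set of vertices claimed by $\mathbf{A}$ in the first $k$ rounds.
   Context: The discrete Voronoi game on a finite graph $G$: two players $\mathbf{A}$ and $\mathbf{B}$ alternately claim vertices of $G$, $\mathbf{A}$ first; in each round $\mathbf{A}$ claims one vertex and then $\mathbf{B}$ claims one vertex; no vertex may be claimed twice. Distances are shortest-path distances in $G$; the distance from a vertex to a set is the minimum distance to an element of the set. A player controls a vertex (at a given moment) if it is strictly closer to that player's claimed vertices than to the other player's claimed vertices.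
   Formalization: The parameter ε ranges over the positive rationals. -}

module Defs where

open import Data.Nat using (ℕ; zero; suc; _≤_)
open import Data.Bool using (Bool; true; false; if_then_else_)
open import Data.Fin using (Fin)
open import Data.List using (List; []; _∷_; length; map; allFin)
open import Data.Nat.ListAction using (sum)
open import Data.List.Membership.Propositional using (_∈_; _∉_)
open import Data.List.Relation.Unary.All using (All)
open import Data.List.Relation.Unary.Unique.Propositional using (Unique)
open import Data.Product using (Σ; ∃; _×_; _,_; proj₁; proj₂)
open import Data.Unit using (⊤)
open import Data.Integer using (+_)
open import Data.Rational using (ℚ; _/_; 1ℚ; _-_; _*_) renaming (_≤_ to _≤ℚ_)
open import Relation.Binary.PropositionalEquality using (_≡_; _≢_)
open import Relation.Nullary using (¬_)

record Graph (n : ℕ) : Set where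
  field
    adj   : Fin n → Fin n → Bool
    sym   : ∀ u v → adj u v ≡ adj v u
    irrefl : ∀ v → adj v v ≡ false
open Graph public

degree : ∀ {n} → Graph n → Fin n → ℕ
degree {n} G v = sum (map (λ w → if adj G v w then 1 else 0) (allFin n))

MaxDegree3 : ∀ {n} → Graph n → Set
MaxDegree3 G = (∀ v → degree G v ≤ 3) × ∃ λ v → degree G v ≡ 3

-- Reach G k u v : there is a walk from u to v of length at most k,
-- i.e. dist(u,v) ≤ k.
data Reach {n : ℕ} (G : Graph n) : ℕ → Fin n → Fin n → Set where
  here : ∀ {k v} → Reach G k v v
  step : ∀ {k u w v} → adj G u w ≡ true → Reach G k w v → Reach G (suc k) u v

Within : ∀ {n} → Graph n → ℕ → Fin n → List (Fin n) → Set
Within G k v S = Σ _ λ s → s ∈ S × Reach G k v s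

-- v is strictly closer to Bs than to As: dist(v,Bs) < dist(v,As)
-- (i.e. for some k, dist(v,Bs) ≤ k but not dist(v,As) ≤ k; this also
-- handles infinite distances in disconnected graphs).
Controls : ∀ {n} → Graph n → List (Fin n) → List (Fin n) → Fin n → Set
Controls G Bs As v = ∃ λ k → Within G k v Bs × ¬ Within G k v As

ControlsFraction : ∀ {n} → Graph n → ℚ → List (Fin n) → List (Fin n) → Set
ControlsFraction {n} G ε Bs As =
  ∃ λ (xs : List (Fin n)) → Unique xs × All (Controls G Bs As) xs
    × ((1ℚ - ε) * (+ n / 1) ≤ℚ (+ length xs / 1))

-- History of the game: list of rounds (a , b), MOST RECENT FIRST.
History : ℕ → Set
History n = List (Fin n × Fin n)

claimed : ∀ {n} → History n → List (Fin n)
claimed [] = []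
claimed ((a , b) ∷ h) = a ∷ b ∷ claimed h

claimedA : ∀ {n} → History n → List (Fin n)
claimedA = map proj₁

claimedB : ∀ {n} → History n → List (Fin n)
claimedB = map proj₂

StrategyB : ℕ → Set
StrategyB n = History n → Fin n → Fin n

play : ∀ {n} → StrategyB n → List (Fin n) → History n
play σ [] = []
play σ (a ∷ as) = (a , σ (play σ as) a) ∷ play σ as

LegalA : ∀ {n} → StrategyB n → List (Fin n) → Set
LegalA σ [] = ⊤
LegalA σ (a ∷ as) = LegalA σ as × a ∉ claimed (play σ as)

Guarantees : ∀ {n} → Graph n → ℕ → ℚ → StrategyB n → Set
Guarantees {n} G t ε σ =
  ∀ (a : Fin n) (as : List (Fin n)) → length (a ∷ as) ≤ t → LegalA σ (a ∷ as) →
    let h = play σ as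
        b = σ h a
    in (b ∉ claimed h) × (b ≢ a)
       × ControlsFraction G ε (b ∷ claimedB h) (a ∷ claimedA h)

module Submission where

-- The graph has m columns and m hubs. Column j is a long tail ending at the first of m spine
-- vertices, consecutive ones at distance 2; hub i is a path of m vertices, and its vertex s is
-- joined by a link of length c to spine vertex s of column i + s (mod m). Almost all vertices
-- lie on the tails.
--
-- From a tail vertex w of column j, the shortest way to hub i runs along the tail and the spine
-- of j up to position σ = j - i, where a link of hub i arrives; replacing i by i + δ decreases σ
-- by δ, and the distance by at least δ. A 1-Lipschitz potential vanishing at w bounds dist(w, ·)
-- from below and shows: when A claims x, each of 2t rotated hub vertices is strictly closer than
-- x to all tail vertices of all columns outside a set of at most 2t + 1 columns spoiled by x.
-- Fewer than 2t vertices are claimed at that moment, so one of these candidates is free and B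
-- takes it. After t rounds B controls the tails of all but t(2t + 1) columns, a (1 - ε)-fraction
-- of the graph once m and the tail length are large enough.

open import Defs hiding (sym)
open import Data.Bool using (true; false; if_then_else_; _∨_)
open import Data.Bool.Properties using (T-≡; ∨-comm)
open import Data.Empty using (⊥; ⊥-elim)
open import Data.Fin using (Fin; zero; suc; toℕ; fromℕ; fromℕ<; inject₁; inject≤; pred)
import Data.Fin.Properties as Finₚ
open import Data.Fin.Properties
  using (toℕ<n; toℕ-fromℕ<; toℕ-fromℕ; toℕ-injective; toℕ-inject₁; toℕ-inject≤; inject≤-injective; +↔⊎; *↔×)
  renaming (_≟_ to _≟ᶠ_)
open import Data.Integer as ℤ using (+[1+_]; -[1+_]; +0; +≤+; 1ℤ)
import Data.Integer.Properties as ℤ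
open import Data.Integer.Tactic.RingSolver using () renaming (solve-∀ to solve-∀ℤ)
open import Data.List using (List; []; _∷_; _++_; length; map; allFin; filter; concatMap; cartesianProductWith)
open import Data.List.Properties using (length-++; length-map; length-tabulate)
open import Data.List.Membership.Propositional using (_∈_; _∉_; find; lose)
open import Data.List.Membership.Propositional.Properties
  using ( ∈-∃++; ∈-++⁻; ∈-++⁺ˡ; ∈-++⁺ʳ; ∈-filter⁺; ∈-filter⁻; ∈-allFin; ∈-map⁺; ∈-map⁻; ∈-concatMap⁺
        ; ∈-cartesianProductWith⁻)
import Data.List.Membership.DecPropositional as DecMembership
open import Data.List.Relation.Binary.Subset.Propositional using (_⊆_)
open import Data.List.Relation.Unary.All as All using (All; []; _∷_; all?)
open import Data.List.Relation.Unary.All.Properties using (¬All⇒Any¬)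
open import Data.List.Relation.Unary.Any using (here; there)
open import Data.List.Relation.Unary.Unique.Propositional using (Unique; []; _∷_)
open import Data.List.Relation.Unary.Unique.Propositional.Properties
  using (allFin⁺; map⁺; filter⁺; cartesianProductWith⁺)
open import Data.Nat using (ℕ; zero; suc; _+_; _*_; _∸_; _⊓_; ∣_-_∣; _≤_; _<_; z≤n; s≤s; _≤?_; _<?_)
open import Data.Nat.ListAction using (sum)
open import Data.Nat.Properties renaming (_≟_ to _≟ⁿ_)
open import Data.Nat.Tactic.RingSolver using (solve-∀)
open import Data.Product using (Σ; ∃; _×_; _,_; proj₁; proj₂)
open import Data.Product.Function.NonDependent.Propositional using (_×-↔_)
open import Data.Rational using (ℚ; mkℚ; 0ℚ; 1ℚ; toℚᵘ; *<*)
  renaming (_≤_ to _≤ℚ_; _<_ to _<ℚ_; _*_ to _*ℚ_; _-_ to _-ℚ_; _/_ to _/ℚ_; -_ to -ℚ_)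
import Data.Rational.Properties as ℚ
open import Data.Rational.Unnormalised as ℚᵘ using (mkℚᵘ; *≤*)
import Data.Rational.Unnormalised.Properties as ℚᵘ
open import Data.Sum using (_⊎_; inj₁; inj₂; [_,_])
open import Data.Sum.Function.Propositional using (_⊎-↔_)
open import Function using (_∘_)
open import Function.Bundles using (_↔_; mk↔ₛ′; Inverse; Equivalence)
open import Function.Properties.Inverse using (↔-refl; ↔-trans)
open import Relation.Binary.Definitions using (Decidable; DecidableEquality)
open import Relation.Binary.PropositionalEquality
  using (_≡_; _≢_; refl; sym; trans; cong; cong₂; subst; subst₂; module ≡-Reasoning)
open import Relation.Nullary using (¬_; yes; no; does; T?)
open import Relation.Nullary.Decidable using (map′; _×-dec_)

Unique-⊆⇒length≤ : ∀ {A : Set} {xs ys : List A} → Unique xs → xs ⊆ ys → length xs ≤ length ys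
Unique-⊆⇒length≤ {xs = []} _ _ = z≤n
Unique-⊆⇒length≤ {xs = x ∷ xs} (x∉xs ∷ !xs) xs⊆ys with ∈-∃++ (xs⊆ys (here refl))
... | us , vs , refl = begin
  suc (length xs)           ≤⟨ s≤s (Unique-⊆⇒length≤ !xs xs⊆us++vs) ⟩
  suc (length (us ++ vs))   ≡⟨ cong suc (length-++ us) ⟩
  suc (length us + length vs) ≡⟨ +-suc (length us) (length vs) ⟨
  length us + length (x ∷ vs) ≡⟨ length-++ us ⟨
  length (us ++ x ∷ vs)     ∎
  where
    open ≤-Reasoning
    xs⊆us++vs : xs ⊆ us ++ vs
    xs⊆us++vs y∈xs with ∈-++⁻ us (xs⊆ys (there y∈xs))
    ... | inj₁ y∈us         = ∈-++⁺ˡ y∈us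
    ... | inj₂ (here refl)  = ⊥-elim (All.lookup x∉xs y∈xs refl)
    ... | inj₂ (there y∈vs) = ∈-++⁺ʳ us y∈vs

length-cartesianProductWith : ∀ {A B C : Set} (f : A → B → C) xs ys →
  length (cartesianProductWith f xs ys) ≡ length xs * length ys
length-cartesianProductWith f []       ys = refl
length-cartesianProductWith f (x ∷ xs) ys = begin
  length (map (f x) ys ++ cartesianProductWith f xs ys)           ≡⟨ length-++ (map (f x) ys) ⟩
  length (map (f x) ys) + length (cartesianProductWith f xs ys)
    ≡⟨ cong₂ _+_ (length-map (f x) ys) (length-cartesianProductWith f xs ys) ⟩
  length ys + length xs * length ys                               ∎
  where open ≡-Reasoning

length-concatMap≤ : ∀ {A B : Set} (f : A → List B) {k} → (∀ x → length (f x) ≤ k) →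
  ∀ xs → length (concatMap f xs) ≤ length xs * k
length-concatMap≤ f f≤ []       = z≤n
length-concatMap≤ f f≤ (x ∷ xs) =
  ≤-trans (≤-reflexive (length-++ (f x))) (+-mono-≤ (f≤ x) (length-concatMap≤ f f≤ xs))

module _ {A : Set} (_≟_ : DecidableEquality A) where

  open DecMembership _≟_ using (_∈?_; _∉?_)

  firstFree : (used candidates : List A) → A → A
  firstFree used cs d with all? (_∈? used) cs
  ... | yes _   = d
  ... | no ¬all = proj₁ (find (¬All⇒Any¬ (_∈? used) cs ¬all))

  firstFree-∈ : ∀ used {cs d} → d ∈ cs → firstFree used cs d ∈ cs
  firstFree-∈ used {cs} d∈ with all? (_∈? used) cs
  ... | yes _   = d∈
  ... | no ¬all = proj₁ (proj₂ (find (¬All⇒Any¬ (_∈? used) cs ¬all)))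

  firstFree-∉ : ∀ used {cs} d → Unique cs → length used < length cs → firstFree used cs d ∉ used
  firstFree-∉ used {cs} d !cs used<cs with all? (_∈? used) cs
  ... | yes cs⊆used = ⊥-elim (<⇒≱ used<cs (Unique-⊆⇒length≤ !cs (All.lookup cs⊆used)))
  ... | no ¬all     = proj₂ (proj₂ (find (¬All⇒Any¬ (_∈? used) cs ¬all)))

  length-filter-∉ : ∀ {xs} ys → Unique xs → length xs ∸ length ys ≤ length (filter (_∉? ys) xs)
  length-filter-∉ {xs} ys !xs = m≤n+o⇒m∸n≤o (length xs) (length ys) (begin
    length xs                                 ≤⟨ Unique-⊆⇒length≤ !xs xs⊆ ⟩
    length (ys ++ filter (_∉? ys) xs)         ≡⟨ length-++ ys ⟩
    length ys + length (filter (_∉? ys) xs)   ∎)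
    where
      open ≤-Reasoning
      xs⊆ : xs ⊆ ys ++ filter (_∉? ys) xs
      xs⊆ {x} x∈xs with x ∈? ys
      ... | yes x∈ys = ∈-++⁺ˡ x∈ys
      ... | no  x∉ys = ∈-++⁺ʳ ys (∈-filter⁺ (_∉? ys) x∈xs x∉ys)

[1-ε]*n≤kᵘ : ∀ a d n k → d * n ≤ suc d * k →
  ((mkℚᵘ (ℤ.+ 1) 0 ℚᵘ.- mkℚᵘ +[1+ a ] d) ℚᵘ.* mkℚᵘ (ℤ.+ n) 0) ℚᵘ.≤ mkℚᵘ (ℤ.+ k) 0
[1-ε]*n≤kᵘ a d n k dn≤ = *≤* (begin
  (ℤ.+ 1 ℤ.* ℤ.+ suc d ℤ.+ -[1+ a ] ℤ.* ℤ.+ 1) ℤ.* ℤ.+ n ℤ.* ℤ.+ 1   ≡⟨ expand (ℤ.+ d) (ℤ.+ a) (ℤ.+ n) ⟩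
  ℤ.+ d ℤ.* ℤ.+ n ℤ.- ℤ.+ a ℤ.* ℤ.+ n                             ≡⟨ cong₂ ℤ._-_ (ℤ.pos-* d n) (ℤ.pos-* a n) ⟨
  ℤ.+ (d * n) ℤ.- ℤ.+ (a * n)                                     ≤⟨ ℤ.i-j≤i (ℤ.+ (d * n)) (ℤ.+ (a * n)) ⟩
  ℤ.+ (d * n)                                                     ≤⟨ +≤+ dn≤ ⟩
  ℤ.+ (suc d * k)                                                 ≡⟨ cong ℤ.+_ (*-comm (suc d) k) ⟩
  ℤ.+ (k * suc d)                                                 ≡⟨ ℤ.pos-* k (suc d) ⟩
  ℤ.+ k ℤ.* ℤ.+ suc d                                             ≡⟨ cong (λ x → ℤ.+ k ℤ.* ℤ.+ x) 1+d≡ ⟨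
  ℤ.+ k ℤ.* ℤ.+ (suc (d + 0 * suc d) * 1)                         ∎)
  where
    open ℤ.≤-Reasoning
    1+d≡ : suc (d + 0 * suc d) * 1 ≡ suc d
    1+d≡ = trans (*-identityʳ _) (cong suc (+-identityʳ d))
    expand : ∀ D A N → (1ℤ ℤ.* (1ℤ ℤ.+ D) ℤ.+ ℤ.- (1ℤ ℤ.+ A) ℤ.* 1ℤ) ℤ.* N ℤ.* 1ℤ ≡ D ℤ.* N ℤ.- A ℤ.* N
    expand = solve-∀ℤ

-- 0 < ε = (1 + a)/(1 + d) gives 1 - ε ≤ d/(1 + d).
[1-ε]*n≤k : ∀ ε → 0ℚ <ℚ ε → ∀ n k → ℚ.denominator-1 ε * n ≤ suc (ℚ.denominator-1 ε) * k →
  (1ℚ -ℚ ε) *ℚ (ℤ.+ n /ℚ 1) ≤ℚ ℤ.+ k /ℚ 1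
[1-ε]*n≤k ε@(mkℚ +[1+ a ] d _) _ n k dn≤ =
  ℚ.toℚᵘ-cancel-≤ (ℚᵘ.≤-respˡ-≃ (ℚᵘ.≃-sym toℚᵘ-lhs)
    (ℚᵘ.≤-respʳ-≃ (ℚᵘ.≃-sym (ℚ.toℚᵘ-fromℚᵘ (mkℚᵘ (ℤ.+ k) 0))) ([1-ε]*n≤kᵘ a d n k dn≤)))
  where
    toℚᵘ-lhs : toℚᵘ ((1ℚ -ℚ ε) *ℚ (ℤ.+ n /ℚ 1)) ℚᵘ.≃ (mkℚᵘ (ℤ.+ 1) 0 ℚᵘ.- mkℚᵘ +[1+ a ] d) ℚᵘ.* mkℚᵘ (ℤ.+ n) 0
    toℚᵘ-lhs = ℚᵘ.≃-trans (ℚ.toℚᵘ-homo-* (1ℚ -ℚ ε) (ℤ.+ n /ℚ 1))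
      (ℚᵘ.*-cong (ℚᵘ.≃-trans (ℚ.toℚᵘ-homo-+ 1ℚ (-ℚ ε)) (ℚᵘ.+-cong (ℚᵘ.≃-refl {toℚᵘ 1ℚ}) (ℚ.toℚᵘ-homo‿- ε)))
                 (ℚ.toℚᵘ-fromℚᵘ (mkℚᵘ (ℤ.+ n) 0)))
[1-ε]*n≤k (mkℚ +0 _ _) (*<* (ℤ.+<+ ())) _ _ _
[1-ε]*n≤k (mkℚ -[1+ _ ] _ _) (*<* ()) _ _ _

Near : ℕ → ℕ → Set
Near a b = a ≤ suc b × b ≤ suc a

Near-refl : ∀ a → Near a a
Near-refl a = n≤1+n a , n≤1+n a

Near-sym : ∀ {a b} → Near a b → Near b a
Near-sym (a≤ , b≤) = b≤ , a≤

Near-suc : ∀ a → Near a (suc a)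
Near-suc a = m≤n⇒m≤1+n (n≤1+n a) , ≤-refl

Near-+ˡ : ∀ k {a b} → Near a b → Near (k + a) (k + b)
Near-+ˡ k {a} {b} (a≤ , b≤) = ≤-trans (+-monoʳ-≤ k a≤) (≤-reflexive (+-suc k b)) ,
                             ≤-trans (+-monoʳ-≤ k b≤) (≤-reflexive (+-suc k a))

Near-⊓ : ∀ K {a b} → Near a b → Near (a ⊓ K) (b ⊓ K)
Near-⊓ K (a≤ , b≤) = ⊓-step a≤ , ⊓-step b≤
  where
    ⊓-step : ∀ {x y} → x ≤ suc y → x ⊓ K ≤ suc (y ⊓ K)
    ⊓-step x≤ = ≤-trans (⊓-monoˡ-≤ K x≤) (⊓-monoʳ-≤ (suc _) (n≤1+n K))

∣n-1+n∣≡1 : ∀ y → ∣ y - suc y ∣ ≡ 1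
∣n-1+n∣≡1 zero    = refl
∣n-1+n∣≡1 (suc y) = ∣n-1+n∣≡1 y

Near-∣-∣ : ∀ x y → Near ∣ x - y ∣ ∣ x - suc y ∣
Near-∣-∣ x y = triangle x (suc y) y (trans (∣-∣-comm (suc y) y) (∣n-1+n∣≡1 y)) , triangle x y (suc y) (∣n-1+n∣≡1 y)
  where
    triangle : ∀ x y z → ∣ y - z ∣ ≡ 1 → ∣ x - z ∣ ≤ suc ∣ x - y ∣
    triangle x y z ∣y-z∣≡1 =
      ≤-trans (∣-∣-triangle x y z) (≤-reflexive (trans (cong (∣ x - y ∣ +_) ∣y-z∣≡1) (+-comm _ 1)))

Near-⊓-suc : ∀ {a} K → a ≤ K → Near a (suc a ⊓ K)
Near-⊓-suc {a} K a≤K = subst (λ x → Near x (suc a ⊓ K)) (m≤n⇒m⊓n≡m a≤K) (Near-⊓ K (Near-suc a))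

∣-∣-shift : ∀ x d q c → x + x + c + ∣ q - x ∣ + d ≤ (x + d) + (x + d) + c + ∣ q - (x + d) ∣
∣-∣-shift x d q c = begin
  x + x + c + ∣ q - x ∣ + d                   ≤⟨ +-monoˡ-≤ d (+-monoʳ-≤ (x + x + c) ∣q-x∣≤) ⟩
  x + x + c + (∣ q - (x + d) ∣ + d) + d       ≡⟨ rearrange x d c ∣ q - (x + d) ∣ ⟩
  (x + d) + (x + d) + c + ∣ q - (x + d) ∣     ∎
  where
    open ≤-Reasoning
    rearrange : ∀ x d c a → x + x + c + (a + d) + d ≡ (x + d) + (x + d) + c + a
    rearrange = solve-∀
    ∣q-x∣≤ : ∣ q - x ∣ ≤ ∣ q - (x + d) ∣ + d
    ∣q-x∣≤ = ≤-trans (∣-∣-triangle q (x + d) x)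
                     (≤-reflexive (cong (∣ q - (x + d) ∣ +_) (trans (∣-∣-comm (x + d) x) (∣m-m+n∣≡n x d))))

-- Addition and subtraction modulo m, for arguments below m.
module Modular (m : ℕ) where

  infixl 6 _⊕_ _⊖_

  _⊕_ : ℕ → ℕ → ℕ
  i ⊕ s with i + s <? m
  ... | yes _ = i + s
  ... | no  _ = i + s ∸ m

  _⊖_ : ℕ → ℕ → ℕ
  j ⊖ i with i ≤? j
  ... | yes _ = j ∸ i
  ... | no  _ = j + m ∸ i

  private
    ∸-unique : ∀ {a b c} → c + b ≡ a → a ∸ b ≡ c
    ∸-unique {b = b} {c} refl = m+n∸n≡m c b

    no-wrap : ∀ {u i s x} → u + m ≡ i + s → s < m → x ≤ u → i ≤ x → ⊥
    no-wrap {i = i} e s<m x≤u i≤x = <-irrefl refl (<-≤-trans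
      (subst (_< i + m) (sym e) (+-monoʳ-< i s<m)) (+-monoˡ-≤ m (≤-trans i≤x x≤u)))

    i+[j+m∸i]≡j+m : ∀ {i j} → i < m → i + (j + m ∸ i) ≡ j + m
    i+[j+m∸i]≡j+m {i} {j} i<m = m+[n∸m]≡n (≤-trans (<⇒≤ i<m) (m≤n+m m j))

  ⊕-< : ∀ {i s} → i < m → s < m → i ⊕ s < m
  ⊕-< {i} {s} i<m s<m with i + s <? m
  ... | yes p = p
  ... | no ¬p = +-cancelʳ-< m _ m (subst (_< m + m) (sym (m∸n+n≡m (≮⇒≥ ¬p))) (+-mono-< i<m s<m))

  ⊖-< : ∀ {i j} → i < m → j < m → j ⊖ i < m
  ⊖-< {i} {j} i<m j<m with i ≤? j
  ... | yes _ = ≤-<-trans (m∸n≤m j i) j<m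
  ... | no i≰j = +-cancelʳ-< i _ m (subst (_< m + i) (sym (m∸n+n≡m (≤-trans (<⇒≤ i<m) (m≤n+m m j))))
                                     (subst (_< m + i) (+-comm m j) (+-monoʳ-< m (≰⇒> i≰j))))

  ⊕-comm : ∀ i s → i ⊕ s ≡ s ⊕ i
  ⊕-comm i s with i + s <? m | s + i <? m
  ... | yes _ | yes _ = +-comm i s
  ... | no  _ | no  _ = cong (_∸ m) (+-comm i s)
  ... | yes p | no ¬q = ⊥-elim (¬q (subst (_< m) (+-comm i s) p))
  ... | no ¬p | yes q = ⊥-elim (¬p (subst (_< m) (+-comm s i) q))

  i⊕[j⊖i]≡j : ∀ {i j} → i < m → j < m → i ⊕ (j ⊖ i) ≡ j
  i⊕[j⊖i]≡j {i} {j} i<m j<m with i ≤? j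
  ... | yes i≤j with i + (j ∸ i) <? m
  ...   | yes _ = m+[n∸m]≡n i≤j
  ...   | no ¬p = ⊥-elim (¬p (subst (_< m) (sym (m+[n∸m]≡n i≤j)) j<m))
  i⊕[j⊖i]≡j {i} {j} i<m j<m | no _ with i + (j + m ∸ i) <? m
  ...   | yes p = ⊥-elim (<-irrefl refl (≤-<-trans (≤-trans (m≤n+m m j) (≤-reflexive (sym (i+[j+m∸i]≡j+m i<m)))) p))
  ...   | no  _ = trans (cong (_∸ m) (i+[j+m∸i]≡j+m i<m)) (m+n∸n≡m j m)

  [i⊕s]⊖i≡s : ∀ {i s} → i < m → s < m → (i ⊕ s) ⊖ i ≡ s
  [i⊕s]⊖i≡s {i} {s} i<m s<m with i + s <? m
  ... | yes _ with i ≤? i + s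
  ...   | yes _  = m+n∸m≡n i s
  ...   | no ¬p  = ⊥-elim (¬p (m≤m+n i s))
  [i⊕s]⊖i≡s {i} {s} i<m s<m | no ¬q with i ≤? i + s ∸ m
  ...   | yes p  = ⊥-elim (no-wrap (m∸n+n≡m (≮⇒≥ ¬q)) s<m p ≤-refl)
  ...   | no  _  = trans (cong (_∸ i) (m∸n+n≡m (≮⇒≥ ¬q))) (m+n∸m≡n i s)

  [i⊕s]⊖s≡i : ∀ {i s} → i < m → s < m → (i ⊕ s) ⊖ s ≡ i
  [i⊕s]⊖s≡i {i} {s} i<m s<m = trans (cong (_⊖ s) (⊕-comm i s)) ([i⊕s]⊖i≡s s<m i<m)

  [i⊕s]⊖[i⊕δ]≡s∸δ : ∀ {i s δ} → i < m → s < m → δ ≤ s → (i ⊕ s) ⊖ (i ⊕ δ) ≡ s ∸ δ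
  [i⊕s]⊖[i⊕δ]≡s∸δ {i} {s} {δ} i<m s<m δ≤s with i + s <? m
  ... | yes qs with i + δ <? m
  ...   | no ¬qd = ⊥-elim (¬qd (≤-<-trans (+-monoʳ-≤ i δ≤s) qs))
  ...   | yes _ with i + δ ≤? i + s
  ...     | yes _ = [m+n]∸[m+o]≡n∸o i s δ
  ...     | no ¬p = ⊥-elim (¬p (+-monoʳ-≤ i δ≤s))
  [i⊕s]⊖[i⊕δ]≡s∸δ {i} {s} {δ} i<m s<m δ≤s | no ¬qs with i + δ <? m
  ...   | yes _ with i + δ ≤? i + s ∸ m
  ...     | yes p = ⊥-elim (no-wrap (m∸n+n≡m (≮⇒≥ ¬qs)) s<m p (m≤m+n i δ))
  ...     | no  _ = trans (cong (_∸ (i + δ)) (m∸n+n≡m (≮⇒≥ ¬qs))) ([m+n]∸[m+o]≡n∸o i s δ)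
  [i⊕s]⊖[i⊕δ]≡s∸δ {i} {s} {δ} i<m s<m δ≤s | no ¬qs | no ¬qd with i + δ ∸ m ≤? i + s ∸ m
  ...     | no ¬p = ⊥-elim (¬p (∸-monoˡ-≤ m (+-monoʳ-≤ i δ≤s)))
  ...     | yes _ = ∸-unique (begin
    s ∸ δ + (i + δ ∸ m) ≡⟨ +-∸-assoc (s ∸ δ) (≮⇒≥ ¬qd) ⟨
    s ∸ δ + (i + δ) ∸ m ≡⟨ cong (_∸ m) (+-comm (s ∸ δ) (i + δ)) ⟩
    i + δ + (s ∸ δ) ∸ m ≡⟨ cong (_∸ m) (+-assoc i δ (s ∸ δ)) ⟩
    i + (δ + (s ∸ δ)) ∸ m ≡⟨ cong (λ x → i + x ∸ m) (m+[n∸m]≡n δ≤s) ⟩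
    i + s ∸ m ∎)
    where open ≡-Reasoning

  j⊖[i⊕δ]≡[j⊖i]∸δ : ∀ {i j δ} → i < m → j < m → δ ≤ j ⊖ i → j ⊖ (i ⊕ δ) ≡ (j ⊖ i) ∸ δ
  j⊖[i⊕δ]≡[j⊖i]∸δ {i} {j} {δ} i<m j<m δ≤ = trans (cong (_⊖ (i ⊕ δ)) (sym (i⊕[j⊖i]≡j i<m j<m)))
                                                ([i⊕s]⊖[i⊕δ]≡s∸δ i<m (⊖-< i<m j<m) δ≤)

  infixl 6 _⊕ᶠ_ _⊖ᶠ_

  _⊕ᶠ_ : Fin m → Fin m → Fin m
  i ⊕ᶠ s = fromℕ< (⊕-< (toℕ<n i) (toℕ<n s))

  _⊖ᶠ_ : Fin m → Fin m → Fin m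
  j ⊖ᶠ i = fromℕ< (⊖-< (toℕ<n i) (toℕ<n j))

  toℕ-⊕ᶠ : ∀ i s → toℕ (i ⊕ᶠ s) ≡ toℕ i ⊕ toℕ s
  toℕ-⊕ᶠ i s = toℕ-fromℕ< (⊕-< (toℕ<n i) (toℕ<n s))

  toℕ-⊖ᶠ : ∀ j i → toℕ (j ⊖ᶠ i) ≡ toℕ j ⊖ toℕ i
  toℕ-⊖ᶠ j i = toℕ-fromℕ< (⊖-< (toℕ<n i) (toℕ<n j))

  [i⊕ᶠs]⊖ᶠs≡i : ∀ i s → (i ⊕ᶠ s) ⊖ᶠ s ≡ i
  [i⊕ᶠs]⊖ᶠs≡i i s = toℕ-injective (begin
    toℕ ((i ⊕ᶠ s) ⊖ᶠ s)       ≡⟨ toℕ-⊖ᶠ (i ⊕ᶠ s) s ⟩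
    toℕ (i ⊕ᶠ s) ⊖ toℕ s      ≡⟨ cong (_⊖ toℕ s) (toℕ-⊕ᶠ i s) ⟩
    (toℕ i ⊕ toℕ s) ⊖ toℕ s   ≡⟨ [i⊕s]⊖s≡i (toℕ<n i) (toℕ<n s) ⟩
    toℕ i                     ∎)
    where open ≡-Reasoning

  i⊕ᶠ[j⊖ᶠi]≡j : ∀ i j → i ⊕ᶠ (j ⊖ᶠ i) ≡ j
  i⊕ᶠ[j⊖ᶠi]≡j i j = toℕ-injective (begin
    toℕ (i ⊕ᶠ (j ⊖ᶠ i))        ≡⟨ toℕ-⊕ᶠ i (j ⊖ᶠ i) ⟩
    toℕ i ⊕ toℕ (j ⊖ᶠ i)       ≡⟨ cong (toℕ i ⊕_) (toℕ-⊖ᶠ j i) ⟩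
    toℕ i ⊕ (toℕ j ⊖ toℕ i)    ≡⟨ i⊕[j⊖i]≡j (toℕ<n i) (toℕ<n j) ⟩
    toℕ j                      ∎)
    where open ≡-Reasoning

  [i⊕ᶠs]⊖ᶠi≡s : ∀ i s → (i ⊕ᶠ s) ⊖ᶠ i ≡ s
  [i⊕ᶠs]⊖ᶠi≡s i s = toℕ-injective (begin
    toℕ ((i ⊕ᶠ s) ⊖ᶠ i)       ≡⟨ toℕ-⊖ᶠ (i ⊕ᶠ s) i ⟩
    toℕ (i ⊕ᶠ s) ⊖ toℕ i      ≡⟨ cong (_⊖ toℕ i) (toℕ-⊕ᶠ i s) ⟩
    (toℕ i ⊕ toℕ s) ⊖ toℕ i   ≡⟨ [i⊕s]⊖i≡s (toℕ<n i) (toℕ<n s) ⟩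
    toℕ s                     ∎)
    where open ≡-Reasoning

  toℕ-j⊖ᶠ[i⊕ᶠδ] : ∀ i j δ → toℕ δ ≤ toℕ (j ⊖ᶠ i) → toℕ (j ⊖ᶠ (i ⊕ᶠ δ)) ≡ toℕ (j ⊖ᶠ i) ∸ toℕ δ
  toℕ-j⊖ᶠ[i⊕ᶠδ] i j δ δ≤ = begin
    toℕ (j ⊖ᶠ (i ⊕ᶠ δ))          ≡⟨ toℕ-⊖ᶠ j (i ⊕ᶠ δ) ⟩
    toℕ j ⊖ toℕ (i ⊕ᶠ δ)         ≡⟨ cong (toℕ j ⊖_) (toℕ-⊕ᶠ i δ) ⟩
    toℕ j ⊖ (toℕ i ⊕ toℕ δ)      ≡⟨ j⊖[i⊕δ]≡[j⊖i]∸δ (toℕ<n i) (toℕ<n j) (subst (toℕ δ ≤_) (toℕ-⊖ᶠ j i) δ≤) ⟩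
    (toℕ j ⊖ toℕ i) ∸ toℕ δ      ≡⟨ cong (_∸ toℕ δ) (toℕ-⊖ᶠ j i) ⟨
    toℕ (j ⊖ᶠ i) ∸ toℕ δ         ∎
    where open ≡-Reasoning

  ⊕ᶠ-cancelˡ : ∀ i {s s′} → i ⊕ᶠ s ≡ i ⊕ᶠ s′ → s ≡ s′
  ⊕ᶠ-cancelˡ i {s} {s′} e = trans (sym ([i⊕ᶠs]⊖ᶠi≡s i s)) (trans (cong (_⊖ᶠ i) e) ([i⊕ᶠs]⊖ᶠi≡s i s′))

Reach-weaken : ∀ {n} {G : Graph n} {k k′ u v} → k ≤ k′ → Reach G k u v → Reach G k′ u v
Reach-weaken _       here        = here
Reach-weaken (s≤s p) (step e r) = step e (Reach-weaken p r)

Reach-trans : ∀ {n} {G : Graph n} {k l u v w} → Reach G k u v → Reach G l v w → Reach G (k + l) u w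
Reach-trans {k = k} {l} here r′ = Reach-weaken (m≤n+m l k) r′
Reach-trans (step e r) r′       = step e (Reach-trans r r′)

Reach-sym : ∀ {n} {G : Graph n} {k u v} → Reach G k u v → Reach G k v u
Reach-sym here = here
Reach-sym {G = G} {suc k} (step {u = u} {w} e r) =
  Reach-weaken (≤-reflexive (+-comm k 1)) (Reach-trans (Reach-sym r) (step (trans (Graph.sym G w u) e) here))

module _ {n} {G : Graph n} {k} (f : Fin k → Fin n) {ℓ}
         (f-step : ∀ {p p′ : Fin k} → suc (toℕ p) ≡ toℕ p′ → Reach G ℓ (f p) (f p′)) where

  Reach-ascending : ∀ d {p q : Fin k} → toℕ p + d ≡ toℕ q → Reach G (d * ℓ) (f p) (f q)
  Reach-ascending zero    {p} {q} p≡q rewrite toℕ-injective (trans (sym (+-identityʳ (toℕ p))) p≡q) = here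
  Reach-ascending (suc d) {p} {q} p+d+1≡q =
    Reach-trans (f-step (sym (toℕ-fromℕ< p+1<k))) (Reach-ascending d p+1+d≡q)
    where
      p+1<k : suc (toℕ p) < k
      p+1<k = ≤-<-trans (≤-trans (m<m+n (toℕ p) (s≤s z≤n)) (≤-reflexive p+d+1≡q)) (toℕ<n q)
      p+1+d≡q : toℕ (fromℕ< p+1<k) + d ≡ toℕ q
      p+1+d≡q = trans (cong (_+ d) (toℕ-fromℕ< p+1<k)) (trans (sym (+-suc (toℕ p) d)) p+d+1≡q)

  Reach-along : ∀ (p q : Fin k) → Reach G (∣ toℕ p - toℕ q ∣ * ℓ) (f p) (f q)
  Reach-along p q with ≤-total (toℕ p) (toℕ q)
  ... | inj₁ p≤q rewrite m≤n⇒∣m-n∣≡n∸m p≤q = Reach-ascending (toℕ q ∸ toℕ p) (m+[n∸m]≡n p≤q)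
  ... | inj₂ q≤p rewrite m≤n⇒∣n-m∣≡n∸m q≤p = Reach-sym (Reach-ascending (toℕ p ∸ toℕ q) (m+[n∸m]≡n q≤p))

Lipschitz : ∀ {n} → Graph n → (Fin n → ℕ) → Set
Lipschitz G ψ = ∀ u w → adj G u w ≡ true → ψ w ≤ suc (ψ u)

Lipschitz⇒Reach-bound : ∀ {n} {G : Graph n} {ψ} → Lipschitz G ψ →
  ∀ {k u v} → Reach G k u v → ψ v ≤ k + ψ u
Lipschitz⇒Reach-bound {ψ = ψ} _   {k} {u} here = m≤n+m (ψ u) k
Lipschitz⇒Reach-bound {ψ = ψ} lip {suc k} {u} (step {w = w} e r) = begin
  ψ _           ≤⟨ Lipschitz⇒Reach-bound lip r ⟩
  k + ψ w       ≤⟨ +-monoʳ-≤ k (lip u w e) ⟩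
  k + suc (ψ u) ≡⟨ +-suc k (ψ u) ⟩
  suc k + ψ u   ∎
  where open ≤-Reasoning

module _ {n} (G : Graph n) (v : Fin n) where

  neighbours : List (Fin n)
  neighbours = filter (T? ∘ adj G v) (allFin n)

  degree≡length-neighbours : degree G v ≡ length neighbours
  degree≡length-neighbours = go (allFin n)
    where
      go : ∀ xs → sum (map (λ w → if adj G v w then 1 else 0) xs) ≡ length (filter (T? ∘ adj G v) xs)
      go [] = refl
      go (x ∷ xs) with adj G v x
      ... | true  = cong suc (go xs)
      ... | false = go xs

  degree≤length : ∀ {ws} → (∀ {w} → adj G v w ≡ true → w ∈ ws) → degree G v ≤ length ws
  degree≤length ⊆ws rewrite degree≡length-neighbours =
    Unique-⊆⇒length≤ (filter⁺ (T? ∘ adj G v) (allFin⁺ n))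
                     (⊆ws ∘ Equivalence.to T-≡ ∘ proj₂ ∘ ∈-filter⁻ (T? ∘ adj G v) {xs = allFin n})

  length≤degree : ∀ {ws} → Unique ws → All (λ w → adj G v w ≡ true) ws → length ws ≤ degree G v
  length≤degree !ws adjs rewrite degree≡length-neighbours =
    Unique-⊆⇒length≤ !ws λ w∈ →
      ∈-filter⁺ (T? ∘ adj G v) (∈-allFin _) (Equivalence.from T-≡ (All.lookup adjs w∈))

module SymmetricClosure {n} {E : Fin n → Fin n → Set} (E? : Decidable E) (E-irrefl : ∀ u → ¬ E u u) where

  graph : Graph n
  graph = record
    { adj    = λ u v → does (E? u v) ∨ does (E? v u)
    ; sym    = λ u v → ∨-comm (does (E? u v)) (does (E? v u))
    ; irrefl = E-irrefl⇒false
    }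
    where
      E-irrefl⇒false : ∀ u → does (E? u u) ∨ does (E? u u) ≡ false
      E-irrefl⇒false u with E? u u
      ... | yes e = ⊥-elim (E-irrefl u e)
      ... | no _  = refl

  adj⇒E : ∀ {u v} → adj graph u v ≡ true → E u v ⊎ E v u
  adj⇒E {u} {v} uv with E? u v | E? v u
  ... | yes e | _     = inj₁ e
  ... | no _  | yes e = inj₂ e

  E⇒adj : ∀ {u v} → E u v ⊎ E v u → adj graph u v ≡ true
  E⇒adj {u} {v} e with E? u v | E? v u
  ... | yes _  | _      = refl
  ... | no  _  | yes _  = refl
  ... | no ¬uv | no ¬vu = ⊥-elim ([ ¬uv , ¬vu ] e)

-- For D a lower bound of dist(w, ·), b is then strictly closer to w than a.
Dominated : ∀ {n} → Graph n → Fin n → (Fin n → ℕ) → Fin n × Fin n → Set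
Dominated G w D (a , b) = ∃ λ U → Reach G U w b × U < D a

module _ {n} {G : Graph n} {w : Fin n} {D : Fin n → ℕ} where

  private
    closest-reply : ∀ r rs → All (Dominated G w D) (r ∷ rs) →
      ∃ λ k → Within G k w (claimedB (r ∷ rs)) × All (λ a → k < D a) (claimedA (r ∷ rs))
    closest-reply (a , b) [] ((U , w→b , U<) ∷ []) = U , (b , here refl , w→b) , (U< ∷ [])
    closest-reply (a , b) (r′ ∷ rs) ((U , w→b , U<) ∷ doms) with closest-reply r′ rs doms
    ... | k , (b′ , b′∈ , w→b′) , k<  with U ≤? k
    ...   | yes U≤k = U , (b , here refl , w→b) , U< ∷ All.map (≤-<-trans U≤k) k<
    ...   | no  U≰k = k , (b′ , there b′∈ , w→b′) , <-trans (≰⇒> U≰k) U< ∷ k<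

  Dominated⇒Controls : (∀ {k v} → Reach G k w v → D v ≤ k) → ∀ r rs →
    All (Dominated G w D) (r ∷ rs) → Controls G (claimedB (r ∷ rs)) (claimedA (r ∷ rs)) w
  Dominated⇒Controls D≤dist r rs doms with closest-reply r rs doms
  ... | k , withinB , k< = k , withinB , λ (a , a∈ , w→a) → <⇒≱ (All.lookup k< a∈) (D≤dist w→a)

length-play : ∀ {n} (σ : StrategyB n) as → length (play σ as) ≡ length as
length-play σ []       = refl
length-play σ (a ∷ as) = cong suc (length-play σ as)

length-claimed : ∀ {n} (σ : StrategyB n) as → length (claimed (play σ as)) ≡ length as + length as
length-claimed σ []       = refl
length-claimed σ (a ∷ as) = cong suc (trans (cong suc (length-claimed σ as)) (sym (+-suc (length as) (length as))))

-- The graph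

-- The successor, with junk value i at the last element.
next : ∀ {k} → Fin k → Fin k
next {k} i with suc (toℕ i) <? k
... | yes i+1<k = fromℕ< i+1<k
... | no  _     = i

next-unique : ∀ {k} {i i′ : Fin k} → suc (toℕ i) ≡ toℕ i′ → i′ ≡ next i
next-unique {k} {i} {i′} e with suc (toℕ i) <? k
... | yes i+1<k = toℕ-injective (trans (sym e) (sym (toℕ-fromℕ< i+1<k)))
... | no  i+1≮k = ⊥-elim (i+1≮k (subst (_< k) (sym e) (toℕ<n i′)))

pred-unique : ∀ {k} {i i′ : Fin k} → suc (toℕ i) ≡ toℕ i′ → i ≡ pred i′
pred-unique {i′ = suc i′} e = toℕ-injective (trans (suc-injective e) (sym (toℕ-inject₁ i′)))

module Construction (m₀ L₀ c₀ : ℕ) where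

  m L c′ : ℕ
  m  = suc m₀
  L  = suc L₀
  c′ = suc c₀

  open Modular m public

  -- link i s r is the r-th vertex of the link from hub i s (r = 0) to spine (i ⊕ s) s (r = last);
  -- mid j s sits between spine j s and spine j (s + 1).
  data Vertex : Set where
    tail  : Fin m → Fin L → Vertex
    spine : Fin m → Fin m → Vertex
    mid   : Fin m → Fin m → Vertex
    hub   : Fin m → Fin m → Vertex
    link  : Fin m → Fin m → Fin c′ → Vertex

  last : Fin c′
  last = fromℕ c₀

  -- Every edge once; G is the symmetric closure.
  data Edge : Vertex → Vertex → Set where
    tail-tail  : ∀ {j p p′} → suc (toℕ p) ≡ toℕ p′ → Edge (tail j p) (tail j p′)
    tail-spine : ∀ {j} → Edge (tail j zero) (spine j zero)
    spine-mid  : ∀ {j s} → Edge (spine j s) (mid j s)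
    mid-spine  : ∀ {j s s′} → suc (toℕ s) ≡ toℕ s′ → Edge (mid j s) (spine j s′)
    hub-hub    : ∀ {i q q′} → suc (toℕ q) ≡ toℕ q′ → Edge (hub i q) (hub i q′)
    hub-link   : ∀ {i q} → Edge (hub i q) (link i q zero)
    link-link  : ∀ {i s r r′} → suc (toℕ r) ≡ toℕ r′ → Edge (link i s r) (link i s r′)
    link-spine : ∀ {i s} → Edge (link i s last) (spine (i ⊕ᶠ s) s)

  Edge? : Decidable Edge
  Edge? (tail j p) (tail j′ p′) =
    map′ (λ { (refl , e) → tail-tail e }) (λ { (tail-tail e) → refl , e }) (j ≟ᶠ j′ ×-dec suc (toℕ p) ≟ⁿ toℕ p′)
  Edge? (tail j p) (spine j′ s) =
    map′ (λ { (refl , refl , refl) → tail-spine }) (λ { tail-spine → refl , refl , refl })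
         (j ≟ᶠ j′ ×-dec p ≟ᶠ zero ×-dec s ≟ᶠ zero)
  Edge? (spine j s) (mid j′ s′) =
    map′ (λ { (refl , refl) → spine-mid }) (λ { spine-mid → refl , refl }) (j ≟ᶠ j′ ×-dec s ≟ᶠ s′)
  Edge? (mid j s) (spine j′ s′) =
    map′ (λ { (refl , e) → mid-spine e }) (λ { (mid-spine e) → refl , e }) (j ≟ᶠ j′ ×-dec suc (toℕ s) ≟ⁿ toℕ s′)
  Edge? (hub i q) (hub i′ q′) =
    map′ (λ { (refl , e) → hub-hub e }) (λ { (hub-hub e) → refl , e }) (i ≟ᶠ i′ ×-dec suc (toℕ q) ≟ⁿ toℕ q′)
  Edge? (hub i q) (link i′ s r) =
    map′ (λ { (refl , refl , refl) → hub-link }) (λ { hub-link → refl , refl , refl })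
         (i ≟ᶠ i′ ×-dec q ≟ᶠ s ×-dec r ≟ᶠ zero)
  Edge? (link i s r) (link i′ s′ r′) =
    map′ (λ { (refl , refl , e) → link-link e }) (λ { (link-link e) → refl , refl , e })
         (i ≟ᶠ i′ ×-dec s ≟ᶠ s′ ×-dec suc (toℕ r) ≟ⁿ toℕ r′)
  Edge? (link i s r) (spine j s′) =
    map′ (λ { (refl , refl , refl) → link-spine }) (λ { link-spine → refl , refl , refl })
         (r ≟ᶠ last ×-dec s ≟ᶠ s′ ×-dec j ≟ᶠ i ⊕ᶠ s)
  Edge? (tail _ _)   (mid _ _)    = no λ ()
  Edge? (tail _ _)   (hub _ _)    = no λ ()
  Edge? (tail _ _)   (link _ _ _) = no λ ()
  Edge? (spine _ _)  (tail _ _)   = no λ ()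
  Edge? (spine _ _)  (spine _ _)  = no λ ()
  Edge? (spine _ _)  (hub _ _)    = no λ ()
  Edge? (spine _ _)  (link _ _ _) = no λ ()
  Edge? (mid _ _)    (tail _ _)   = no λ ()
  Edge? (mid _ _)    (mid _ _)    = no λ ()
  Edge? (mid _ _)    (hub _ _)    = no λ ()
  Edge? (mid _ _)    (link _ _ _) = no λ ()
  Edge? (hub _ _)    (tail _ _)   = no λ ()
  Edge? (hub _ _)    (spine _ _)  = no λ ()
  Edge? (hub _ _)    (mid _ _)    = no λ ()
  Edge? (link _ _ _) (tail _ _)   = no λ ()
  Edge? (link _ _ _) (mid _ _)    = no λ ()
  Edge? (link _ _ _) (hub _ _)    = no λ ()

  Edge-irrefl : ∀ x → ¬ Edge x x
  Edge-irrefl _ (tail-tail e) = 1+n≢n e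
  Edge-irrefl _ (hub-hub e)   = 1+n≢n e
  Edge-irrefl _ (link-link e) = 1+n≢n e

  n : ℕ
  n = m * (L + (m + (m + (m + m * c′))))

  private
    Layout : Set
    Layout = Fin m × (Fin L ⊎ Fin m ⊎ Fin m ⊎ Fin m ⊎ Fin m × Fin c′)

    layout↔ : Fin n ↔ Layout
    layout↔ = ↔-trans *↔× (↔-refl ×-↔ ↔-trans +↔⊎ (↔-refl ⊎-↔ ↔-trans +↔⊎ (↔-refl ⊎-↔
                ↔-trans +↔⊎ (↔-refl ⊎-↔ ↔-trans +↔⊎ (↔-refl ⊎-↔ *↔×)))))

    fromLayout : Layout → Vertex
    fromLayout (j , inj₁ p)                        = tail j p
    fromLayout (j , inj₂ (inj₁ s))                 = spine j s
    fromLayout (j , inj₂ (inj₂ (inj₁ s)))          = mid j s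
    fromLayout (i , inj₂ (inj₂ (inj₂ (inj₁ q))))   = hub i q
    fromLayout (i , inj₂ (inj₂ (inj₂ (inj₂ (s , r))))) = link i s r

    toLayout : Vertex → Layout
    toLayout (tail j p)   = j , inj₁ p
    toLayout (spine j s)  = j , inj₂ (inj₁ s)
    toLayout (mid j s)    = j , inj₂ (inj₂ (inj₁ s))
    toLayout (hub i q)    = i , inj₂ (inj₂ (inj₂ (inj₁ q)))
    toLayout (link i s r) = i , inj₂ (inj₂ (inj₂ (inj₂ (s , r))))

    vertex↔ : Fin n ↔ Vertex
    vertex↔ = ↔-trans layout↔ (mk↔ₛ′ fromLayout toLayout from-to to-from)
      where
        from-to : ∀ x → fromLayout (toLayout x) ≡ x
        from-to (tail _ _)   = refl
        from-to (spine _ _)  = refl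
        from-to (mid _ _)    = refl
        from-to (hub _ _)    = refl
        from-to (link _ _ _) = refl
        to-from : ∀ y → toLayout (fromLayout y) ≡ y
        to-from (_ , inj₁ _)                        = refl
        to-from (_ , inj₂ (inj₁ _))                 = refl
        to-from (_ , inj₂ (inj₂ (inj₁ _)))          = refl
        to-from (_ , inj₂ (inj₂ (inj₂ (inj₁ _))))   = refl
        to-from (_ , inj₂ (inj₂ (inj₂ (inj₂ _))))   = refl

  -- Opaque, so that unification never unfolds the encoding.
  abstract
    vertex : Fin n → Vertex
    vertex = Inverse.to vertex↔

    index : Vertex → Fin n
    index = Inverse.from vertex↔

    vertex-index : ∀ x → vertex (index x) ≡ x
    vertex-index = Inverse.strictlyInverseˡ vertex↔

    index-vertex : ∀ u → index (vertex u) ≡ u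
    index-vertex = Inverse.strictlyInverseʳ vertex↔

  index-injective : ∀ {x y} → index x ≡ index y → x ≡ y
  index-injective {x} {y} e = trans (sym (vertex-index x)) (trans (cong vertex e) (vertex-index y))

  open SymmetricClosure {E = λ u v → Edge (vertex u) (vertex v)} (λ u v → Edge? (vertex u) (vertex v))
                        (Edge-irrefl ∘ vertex) public
    renaming (graph to G)

  Edge⇒adj : ∀ {x y} → Edge x y ⊎ Edge y x → adj G (index x) (index y) ≡ true
  Edge⇒adj {x} {y} e =
    E⇒adj (subst₂ (λ a b → Edge a b ⊎ Edge b a) (sym (vertex-index x)) (sym (vertex-index y)) e)

  spine-pred : Fin m → Fin m → Vertex
  spine-pred j zero    = tail j zero
  spine-pred j (suc s) = mid j (inject₁ s)

  link-down : Fin m → Fin m → Fin c′ → Vertex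
  link-down i s zero    = hub i s
  link-down i s (suc r) = link i s (inject₁ r)

  link-up : Fin m → Fin m → Fin c′ → Vertex
  link-up i s r with r ≟ᶠ last
  ... | yes _ = spine (i ⊕ᶠ s) s
  ... | no  _ = link i s (next r)

  adjacent : Vertex → List Vertex
  adjacent (tail j p)   = tail j (pred p) ∷ tail j (next p) ∷ spine j zero ∷ []
  adjacent (spine j s)  = mid j s ∷ spine-pred j s ∷ link (j ⊖ᶠ s) s last ∷ []
  adjacent (mid j s)    = spine j s ∷ spine j (next s) ∷ []
  adjacent (hub i q)    = hub i (pred q) ∷ hub i (next q) ∷ link i q zero ∷ []
  adjacent (link i s r) = link-down i s r ∷ link-up i s r ∷ []

  length-adjacent≤3 : ∀ x → length (adjacent x) ≤ 3
  length-adjacent≤3 (tail _ _)   = ≤-refl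
  length-adjacent≤3 (spine _ _)  = ≤-refl
  length-adjacent≤3 (mid _ _)    = s≤s (s≤s z≤n)
  length-adjacent≤3 (hub _ _)    = ≤-refl
  length-adjacent≤3 (link _ _ _) = s≤s (s≤s z≤n)

  target∈adjacent : ∀ {x y} → Edge x y → y ∈ adjacent x
  target∈adjacent (tail-tail e) = there (here (cong (tail _) (next-unique e)))
  target∈adjacent tail-spine    = there (there (here refl))
  target∈adjacent spine-mid     = here refl
  target∈adjacent (mid-spine e) = there (here (cong (spine _) (next-unique e)))
  target∈adjacent (hub-hub e)   = there (here (cong (hub _) (next-unique e)))
  target∈adjacent hub-link      = there (there (here refl))
  target∈adjacent {link i s r} (link-link e) with r ≟ᶠ last
  ... | yes refl = ⊥-elim (<-irrefl (sym (trans (cong suc (sym (toℕ-fromℕ c₀))) e)) (toℕ<n _))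
  ... | no  _    = there (here (cong (link i s) (next-unique e)))
  target∈adjacent link-spine with last ≟ᶠ last
  ... | yes _     = there (here refl)
  ... | no  last≢ = ⊥-elim (last≢ refl)

  source∈adjacent : ∀ {x y} → Edge y x → y ∈ adjacent x
  source∈adjacent (tail-tail e)                  = here (cong (tail _) (pred-unique e))
  source∈adjacent tail-spine                     = there (here refl)
  source∈adjacent spine-mid                      = here refl
  source∈adjacent (mid-spine {s′ = suc _} e)     = there (here (cong (mid _) (pred-unique e)))
  source∈adjacent (hub-hub e)                    = here (cong (hub _) (pred-unique e))
  source∈adjacent hub-link                       = here refl
  source∈adjacent (link-link {r′ = suc _} e)     = here (cong (link _ _) (pred-unique e))
  source∈adjacent (link-spine {i} {s})           =
    there (there (here (cong (λ k → link k s last) (sym ([i⊕ᶠs]⊖ᶠs≡i i s)))))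

  degree≤3 : ∀ u → degree G u ≤ 3
  degree≤3 u = begin
    degree G u                             ≤⟨ degree≤length G u adj⇒∈ ⟩
    length (map index (adjacent (vertex u))) ≡⟨ length-map index (adjacent (vertex u)) ⟩
    length (adjacent (vertex u))           ≤⟨ length-adjacent≤3 (vertex u) ⟩
    3                                      ∎
    where
      open ≤-Reasoning
      adj⇒∈ : ∀ {w} → adj G u w ≡ true → w ∈ map index (adjacent (vertex u))
      adj⇒∈ {w} uw = subst (_∈ _) (index-vertex w) (∈-map⁺ index ([ target∈adjacent , source∈adjacent ] (adj⇒E uw)))

  maxDegree3 : MaxDegree3 G
  maxDegree3 = degree≤3 , index x , ≤-antisym (degree≤3 (index x)) (length≤degree G (index x) distinct adjacents)
    where
      -- Written as 0 ⊕ᶠ 0, the column is literally the one the link from hub 0 at 0 enters.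
      j = zero ⊕ᶠ zero
      x = spine j zero

      index-≢ : ∀ {y z} → y ≢ z → index y ≢ index z
      index-≢ y≢z = y≢z ∘ index-injective

      distinct : Unique (index (mid j zero) ∷ index (tail j zero) ∷ index (link zero zero last) ∷ [])
      distinct = (index-≢ (λ ()) ∷ index-≢ (λ ()) ∷ []) ∷ (index-≢ (λ ()) ∷ []) ∷ [] ∷ []

      adjacents : All (λ w → adj G (index x) w ≡ true)
                      (index (mid j zero) ∷ index (tail j zero) ∷ index (link zero zero last) ∷ [])
      adjacents = Edge⇒adj (inj₁ spine-mid) ∷ Edge⇒adj (inj₂ tail-spine) ∷ Edge⇒adj (inj₂ link-spine) ∷ []

  edge : ∀ {x y} → Edge x y → Reach G 1 (index x) (index y)
  edge e = step (Edge⇒adj (inj₁ e)) here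

  edge⁻¹ : ∀ {x y} → Edge y x → Reach G 1 (index x) (index y)
  edge⁻¹ e = step (Edge⇒adj (inj₂ e)) here

-- A lower bound for the distance from a tail vertex

module Potential (m₀ L₀ c₀ : ℕ) (3m≤c′ : 3 * suc m₀ ≤ suc c₀) (j : Fin (suc m₀)) (P : Fin (suc L₀)) where

  open Construction m₀ L₀ c₀

  -- ψ x bounds the distance from w = tail j P to x from below (Ψ≤dist). β is the distance from w to
  -- spine j 0, the link of hub i enters column j at spine position σ i, hubCost i q is the length of the
  -- route through that link, and Cap is the length of two links, paid by any route leaving column j.
  β c Cap : ℕ
  β   = suc (toℕ P)
  c   = suc c′
  Cap = c + c

  σ : Fin m → ℕ
  σ i = toℕ (j ⊖ᶠ i)

  hubCost : Fin m → Fin m → ℕ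
  hubCost i q = σ i + σ i + c + ∣ toℕ q - σ i ∣

  hubPot : Fin m → Fin m → ℕ
  hubPot i q = hubCost i q ⊓ Cap

  ψ : Vertex → ℕ
  ψ (tail j′ p) with j′ ≟ᶠ j
  ... | yes _ = ∣ toℕ P - toℕ p ∣
  ... | no  _ = β + Cap
  ψ (spine j′ s) with j′ ≟ᶠ j
  ... | yes _ = β + (toℕ s + toℕ s)
  ... | no  _ = β + Cap
  ψ (mid j′ s) with j′ ≟ᶠ j
  ... | yes _ = β + suc (toℕ s + toℕ s)
  ... | no  _ = β + Cap
  ψ (hub i q) = β + hubPot i q
  ψ (link i s r) with i ⊕ᶠ s ≟ᶠ j
  ... | yes _ = β + (toℕ s + toℕ s + (c′ ∸ toℕ r))
  ... | no  _ = β + ((hubPot i s + suc (toℕ r)) ⊓ Cap)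

  m+m+m≤c : m + m + m ≤ c
  m+m+m≤c = ≤-trans (≤-reflexive (three m)) (≤-trans 3m≤c′ (n≤1+n c′))
    where
      three : ∀ x → x + x + x ≡ 3 * x
      three = solve-∀

  s+s+c≤Cap : ∀ (s : Fin m) → toℕ s + toℕ s + c ≤ Cap
  s+s+c≤Cap s = +-monoˡ-≤ c (≤-trans (+-mono-≤ s≤m s≤m) (≤-trans (m≤m+n (m + m) m) m+m+m≤c))
    where
      s≤m : toℕ s ≤ m
      s≤m = <⇒≤ (toℕ<n s)

  c′∸c₀≡1 : c′ ∸ c₀ ≡ 1
  c′∸c₀≡1 = trans (+-∸-assoc 1 (≤-refl {c₀})) (cong suc (n∸n≡0 c₀))

  c≤hubPot : ∀ i q → c ≤ hubPot i q
  c≤hubPot i q = ⊓-glb (≤-trans (m≤n+m c (σ i + σ i)) (m≤m+n _ _)) (m≤m+n c c)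

  hubCost<Cap : ∀ i q → hubCost i q < Cap
  hubCost<Cap i q = begin-strict
    σ i + σ i + c + ∣ toℕ q - σ i ∣   ≡⟨ swap (σ i) c ∣ toℕ q - σ i ∣ ⟩
    σ i + σ i + ∣ toℕ q - σ i ∣ + c   <⟨ +-monoˡ-< c (≤-trans (+-mono-< (+-mono-< σ<m σ<m) ∣q-σ∣<m) m+m+m≤c) ⟩
    c + c                             ∎
    where
      open ≤-Reasoning
      swap : ∀ x c a → x + x + c + a ≡ x + x + a + c
      swap = solve-∀
      σ<m : σ i < m
      σ<m = toℕ<n (j ⊖ᶠ i)
      ∣q-σ∣<m : ∣ toℕ q - σ i ∣ < m
      ∣q-σ∣<m = ≤-<-trans (∣m-n∣≤m⊔n (toℕ q) (σ i)) (⊔-lub (toℕ<n q) σ<m)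

  hubCost-rotate : ∀ i q (d : Fin m) → toℕ d ≤ σ i → hubCost (i ⊕ᶠ d) q + toℕ d ≤ hubCost i q
  hubCost-rotate i q d d≤σ = begin
    hubCost (i ⊕ᶠ d) q + toℕ d                              ≡⟨ cong (λ x → x + x + c + ∣ toℕ q - x ∣ + toℕ d) σ′≡ ⟩
    hubCost′ (σ i ∸ toℕ d) + toℕ d                          ≤⟨ ∣-∣-shift (σ i ∸ toℕ d) (toℕ d) (toℕ q) c ⟩
    hubCost′ (σ i ∸ toℕ d + toℕ d)                          ≡⟨ cong hubCost′ (m∸n+n≡m d≤σ) ⟩
    hubCost i q                                             ∎
    where
      open ≤-Reasoning
      hubCost′ : ℕ → ℕ
      hubCost′ x = x + x + c + ∣ toℕ q - x ∣
      σ′≡ : σ (i ⊕ᶠ d) ≡ σ i ∸ toℕ d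
      σ′≡ = toℕ-j⊖ᶠ[i⊕ᶠδ] i j d d≤σ

  ψ-Near : ∀ {x y} → Edge x y → Near (ψ x) (ψ y)
  ψ-Near (tail-tail {j′} {p} e) with j′ ≟ᶠ j
  ... | yes _ = subst (λ x → Near ∣ toℕ P - toℕ p ∣ ∣ toℕ P - x ∣) e (Near-∣-∣ (toℕ P) (toℕ p))
  ... | no  _ = Near-refl _
  ψ-Near (tail-spine {j′}) with j′ ≟ᶠ j
  ... | yes _ = subst₂ Near (sym (∣-∣-identityʳ (toℕ P))) (cong suc (sym (+-identityʳ (toℕ P)))) (Near-suc (toℕ P))
  ... | no  _ = Near-refl _
  ψ-Near (spine-mid {j′}) with j′ ≟ᶠ j
  ... | yes _ = Near-+ˡ β (Near-suc _)
  ... | no  _ = Near-refl _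
  ψ-Near (mid-spine {j′} {s} e) with j′ ≟ᶠ j
  ... | yes _ rewrite sym e =
    Near-+ˡ β (subst (Near (suc (toℕ s + toℕ s))) (cong suc (sym (+-suc (toℕ s) (toℕ s)))) (Near-suc _))
  ... | no  _ = Near-refl _
  ψ-Near (hub-hub {i} {q} e) rewrite sym e = Near-+ˡ β (Near-⊓ Cap (Near-+ˡ (σ i + σ i + c)
    (subst₂ Near (∣-∣-comm (σ i) (toℕ q)) (∣-∣-comm (σ i) (suc (toℕ q))) (Near-∣-∣ (σ i) (toℕ q)))))
  ψ-Near (hub-link {i} {q}) with i ⊕ᶠ q ≟ᶠ j
  ... | yes refl =
    Near-+ˡ β (subst (λ x → Near x (toℕ q + toℕ q + c′)) (sym hubPot≡)
                     (Near-sym (Near-+ˡ (toℕ q + toℕ q) (Near-suc c′))))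
    where
      σ≡q : σ i ≡ toℕ q
      σ≡q = cong toℕ ([i⊕ᶠs]⊖ᶠi≡s i q)
      hubPot≡ : hubPot i q ≡ toℕ q + toℕ q + c
      hubPot≡ = begin
        hubPot i q                                  ≡⟨ cong (λ x → (x + x + c + ∣ toℕ q - x ∣) ⊓ Cap) σ≡q ⟩
        (toℕ q + toℕ q + c + ∣ toℕ q - toℕ q ∣) ⊓ Cap ≡⟨ cong (λ x → (toℕ q + toℕ q + c + x) ⊓ Cap) (∣n-n∣≡0 (toℕ q)) ⟩
        (toℕ q + toℕ q + c + 0) ⊓ Cap               ≡⟨ cong (_⊓ Cap) (+-identityʳ _) ⟩
        (toℕ q + toℕ q + c) ⊓ Cap                   ≡⟨ m≤n⇒m⊓n≡m (s+s+c≤Cap q) ⟩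
        toℕ q + toℕ q + c                           ∎
        where open ≡-Reasoning
  ... | no _ =
    Near-+ˡ β (subst (Near (hubPot i q)) (cong (_⊓ Cap) (+-comm 1 (hubPot i q))) (Near-⊓-suc Cap (m⊓n≤n _ Cap)))
  ψ-Near (link-link {i} {s} {r} {r′} e) with i ⊕ᶠ s ≟ᶠ j
  ... | yes _ rewrite sym e = Near-+ˡ β (Near-+ˡ (toℕ s + toℕ s)
    (subst (λ x → Near x (c₀ ∸ toℕ r)) (sym (+-∸-assoc 1 r≤c₀)) (Near-sym (Near-suc _))))
    where
      r≤c₀ : toℕ r ≤ c₀
      r≤c₀ = <⇒≤ (subst (_≤ c₀) (sym e) (≤-pred (toℕ<n r′)))
  ... | no  _ rewrite sym e = Near-+ˡ β (Near-⊓ Cap (Near-+ˡ (hubPot i s) (Near-suc (suc (toℕ r)))))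
  ψ-Near (link-spine {i} {s}) with i ⊕ᶠ s ≟ᶠ j
  ... | yes _ rewrite toℕ-fromℕ c₀ | c′∸c₀≡1 =
    Near-+ˡ β (subst (λ x → Near x (toℕ s + toℕ s)) (+-comm 1 _) (Near-sym (Near-suc _)))
  ... | no  _ rewrite toℕ-fromℕ c₀ = Near-+ˡ β (≤-trans (m⊓n≤n _ Cap) (n≤1+n Cap) , Cap≤)
    where
      Cap≤ : Cap ≤ suc ((hubPot i s + c′) ⊓ Cap)
      Cap≤ = s≤s (⊓-glb (≤-trans (≤-reflexive (+-comm c′ c)) (+-monoˡ-≤ c′ (c≤hubPot i s)))
                        (+-monoˡ-≤ c (n≤1+n c′)))

  Ψ : Fin n → ℕ
  Ψ = ψ ∘ vertex

  w : Fin n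
  w = index (tail j P)

  Ψ-lipschitz : Lipschitz G Ψ
  Ψ-lipschitz u v uv with adj⇒E uv
  ... | inj₁ e = proj₂ (ψ-Near e)
  ... | inj₂ e = proj₁ (ψ-Near e)

  Ψ≤dist : ∀ {k v} → Reach G k w v → Ψ v ≤ k
  Ψ≤dist {k} w→v =
    ≤-trans (Lipschitz⇒Reach-bound Ψ-lipschitz w→v) (≤-reflexive (trans (cong (k +_) Ψw≡0) (+-identityʳ k)))
    where
      Ψw≡0 : Ψ w ≡ 0
      Ψw≡0 rewrite vertex-index (tail j P) with j ≟ᶠ j
      ... | yes _  = ∣n-n∣≡0 (toℕ P)
      ... | no j≢j = ⊥-elim (j≢j refl)

  tail-walk : Reach G (toℕ P) w (index (tail j zero))
  tail-walk = Reach-weaken (≤-reflexive (trans (*-identityʳ _) (∣-∣-identityʳ (toℕ P))))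
                           (Reach-along (index ∘ tail j) (edge ∘ tail-tail) P zero)

  spine-walk : ∀ s → Reach G (toℕ s + toℕ s) (index (spine j zero)) (index (spine j s))
  spine-walk s = Reach-weaken (≤-reflexive (trans (*-comm (toℕ s) 2) (cong (toℕ s +_) (+-identityʳ (toℕ s)))))
                              (Reach-along (index ∘ spine j) via-mid zero s)
    where
      via-mid : ∀ {s s′} → suc (toℕ s) ≡ toℕ s′ → Reach G 2 (index (spine j s)) (index (spine j s′))
      via-mid e = Reach-trans (edge spine-mid) (edge (mid-spine e))

  link-walk : ∀ i s → Reach G c (index (spine (i ⊕ᶠ s) s)) (index (hub i s))
  link-walk i s = Reach-trans (edge⁻¹ link-spine) (Reach-weaken (≤-reflexive length≡)
    (Reach-trans (Reach-along (index ∘ link i s) (edge ∘ link-link) last zero) (edge⁻¹ hub-link)))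
    where
      length≡ : ∣ toℕ last - 0 ∣ * 1 + 1 ≡ c′
      length≡ = begin
        ∣ toℕ last - 0 ∣ * 1 + 1 ≡⟨ cong (_+ 1) (*-identityʳ _) ⟩
        ∣ toℕ last - 0 ∣ + 1     ≡⟨ cong (_+ 1) (trans (∣-∣-identityʳ _) (toℕ-fromℕ c₀)) ⟩
        c₀ + 1                   ≡⟨ +-comm c₀ 1 ⟩
        c′                       ∎
        where open ≡-Reasoning

  hub-walk : ∀ i s q → Reach G ∣ toℕ q - toℕ s ∣ (index (hub i s)) (index (hub i q))
  hub-walk i s q = Reach-weaken (≤-reflexive (trans (*-identityʳ _) (∣-∣-comm (toℕ s) (toℕ q))))
                                (Reach-along (index ∘ hub i) (edge ∘ hub-hub) s q)

  Reach-hub : ∀ i q → Reach G (β + hubCost i q) w (index (hub i q))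
  Reach-hub i q = Reach-weaken (≤-reflexive length≡)
    (Reach-trans tail-walk (Reach-trans (edge tail-spine) (Reach-trans (spine-walk s)
      (Reach-trans spine→hub (hub-walk i s q)))))
    where
      s = j ⊖ᶠ i
      spine→hub : Reach G c (index (spine j s)) (index (hub i s))
      spine→hub = subst (λ x → Reach G c (index (spine x s)) (index (hub i s))) (i⊕ᶠ[j⊖ᶠi]≡j i j)
                        (link-walk i s)
      length≡ : toℕ P + (1 + (σ i + σ i + (c + ∣ toℕ q - σ i ∣))) ≡ β + hubCost i q
      length≡ = trans (+-suc (toℕ P) _) (cong (λ x → suc (toℕ P + x)) (sym (+-assoc (σ i + σ i) c _)))

-- B's strategy

module Reply (m₀ L₀ c₀ K : ℕ) (K<m : K < suc m₀) where

  open Construction m₀ L₀ c₀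

  shift : Fin K → Fin m
  shift δ = inject≤ δ (<⇒≤ K<m)

  shift₁ : Fin K → Fin m
  shift₁ δ = inject≤ (suc δ) K<m

  toℕ-shift : ∀ δ → toℕ (shift δ) ≡ toℕ δ
  toℕ-shift δ = toℕ-inject≤ δ (<⇒≤ K<m)

  toℕ-shift₁ : ∀ δ → toℕ (shift₁ δ) ≡ suc (toℕ δ)
  toℕ-shift₁ δ = toℕ-inject≤ (suc δ) K<m

  shift-injective : ∀ {δ δ′} → shift δ ≡ shift δ′ → δ ≡ δ′
  shift-injective {δ} {δ′} = inject≤-injective (<⇒≤ K<m) (<⇒≤ K<m) δ δ′

  shift₁-injective : ∀ {δ δ′} → shift₁ δ ≡ shift₁ δ′ → δ ≡ δ′
  shift₁-injective {δ} {δ′} = Finₚ.suc-injective ∘ inject≤-injective K<m K<m (suc δ) (suc δ′)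

  private
    hub-injective : ∀ {i q i′ q′} → hub i q ≡ hub i′ q′ → i ≡ i′
    hub-injective refl = refl

  -- Rotating a hub index i by d shortens the route from tail j to hub i by at least d if d ≤ σ i
  -- (hubCost-rotate), so only the columns j with σ i < K are spoiled by a hub or link vertex of hub i.
  reply : Vertex → Fin K → Vertex
  reply (hub i q)    δ = hub (i ⊕ᶠ shift₁ δ) q
  reply (link i s _) δ = hub (i ⊕ᶠ shift δ) s
  reply _            δ = hub (shift δ) zero

  reply-injective : ∀ x {δ δ′} → reply x δ ≡ reply x δ′ → δ ≡ δ′
  reply-injective (tail _ _)   e = shift-injective (hub-injective e)
  reply-injective (spine _ _)  e = shift-injective (hub-injective e)
  reply-injective (mid _ _)    e = shift-injective (hub-injective e)
  reply-injective (hub i _)    e = shift₁-injective (⊕ᶠ-cancelˡ i (hub-injective e))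
  reply-injective (link i _ _) e = shift-injective (⊕ᶠ-cancelˡ i (hub-injective e))

  rotations : Fin m → List (Fin m)
  rotations i = map (λ δ → i ⊕ᶠ shift δ) (allFin K)

  length-rotations : ∀ i → length (rotations i) ≡ K
  length-rotations i = trans (length-map _ (allFin K)) (length-tabulate _)

  spoiled : Vertex → List (Fin m)
  spoiled (tail j _)   = j ∷ []
  spoiled (spine j _)  = j ∷ []
  spoiled (mid j _)    = j ∷ []
  spoiled (hub i _)    = rotations i
  spoiled (link i s _) = i ⊕ᶠ s ∷ rotations i

  length-spoiled : ∀ x → length (spoiled x) ≤ suc K
  length-spoiled (tail _ _)   = s≤s z≤n
  length-spoiled (spine _ _)  = s≤s z≤n
  length-spoiled (mid _ _)    = s≤s z≤n
  length-spoiled (hub i _)    = ≤-trans (≤-reflexive (length-rotations i)) (n≤1+n K)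
  length-spoiled (link i _ _) = s≤s (≤-reflexive (length-rotations i))

module Domination (m₀ L₀ c₀ : ℕ) (3m≤c′ : 3 * suc m₀ ≤ suc c₀) (K : ℕ) (K<m : K < suc m₀)
                  (j : Fin (suc m₀)) (P : Fin (suc L₀)) where

  open Construction m₀ L₀ c₀
  open Reply m₀ L₀ c₀ K K<m
  open Potential m₀ L₀ c₀ 3m≤c′ j P

  far-from-rotations : ∀ i → j ∉ rotations i → K ≤ σ i
  far-from-rotations i j∉ with K ≤? σ i
  ... | yes K≤σ = K≤σ
  ... | no  K≰σ = ⊥-elim (j∉ (subst (_∈ rotations i) j≡ (∈-map⁺ (λ δ → i ⊕ᶠ shift δ) (∈-allFin δ))))
    where
      δ : Fin K
      δ = fromℕ< (≰⇒> K≰σ)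
      j≡ : i ⊕ᶠ shift δ ≡ j
      j≡ = trans (cong (i ⊕ᶠ_) (toℕ-injective (trans (toℕ-shift δ) (toℕ-fromℕ< (≰⇒> K≰σ))))) (i⊕ᶠ[j⊖ᶠi]≡j i j)

  off-column-dominated : ∀ δ → ∃ λ U → Reach G U w (index (hub (shift δ) zero)) × U < β + Cap
  off-column-dominated δ = _ , Reach-hub (shift δ) zero , +-monoʳ-< β (hubCost<Cap (shift δ) zero)

  reply-dominates : ∀ x δ → j ∉ spoiled x → ∃ λ U → Reach G U w (index (reply x δ)) × U < ψ x
  reply-dominates (tail j′ _) δ j∉ with j′ ≟ᶠ j
  ... | yes refl = ⊥-elim (j∉ (here refl))
  ... | no  _    = off-column-dominated δ
  reply-dominates (spine j′ _) δ j∉ with j′ ≟ᶠ j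
  ... | yes refl = ⊥-elim (j∉ (here refl))
  ... | no  _    = off-column-dominated δ
  reply-dominates (mid j′ _) δ j∉ with j′ ≟ᶠ j
  ... | yes refl = ⊥-elim (j∉ (here refl))
  ... | no  _    = off-column-dominated δ
  reply-dominates (hub i q) δ j∉ = _ , Reach-hub i′ q , +-monoʳ-< β (⊓-glb cheaper (hubCost<Cap i′ q))
    where
      i′ = i ⊕ᶠ shift₁ δ
      d≤σ : toℕ (shift₁ δ) ≤ σ i
      d≤σ = ≤-trans (≤-reflexive (toℕ-shift₁ δ)) (≤-trans (toℕ<n δ) (far-from-rotations i j∉))
      cheaper : hubCost i′ q < hubCost i q
      cheaper = begin-strict
        hubCost i′ q                       <⟨ m<m+n _ (s≤s z≤n) ⟩
        hubCost i′ q + suc (toℕ δ)         ≡⟨ cong (hubCost i′ q +_) (toℕ-shift₁ δ) ⟨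
        hubCost i′ q + toℕ (shift₁ δ)      ≤⟨ hubCost-rotate i q (shift₁ δ) d≤σ ⟩
        hubCost i q                        ∎
        where open ≤-Reasoning
  reply-dominates (link i s r) δ j∉ with i ⊕ᶠ s ≟ᶠ j
  ... | yes refl = ⊥-elim (j∉ (here refl))
  ... | no  _    = _ , Reach-hub i′ s , +-monoʳ-< β (⊓-glb cheaper′ (hubCost<Cap i′ s))
    where
      i′ = i ⊕ᶠ shift δ
      d≤σ : toℕ (shift δ) ≤ σ i
      d≤σ = ≤-trans (≤-reflexive (toℕ-shift δ)) (≤-trans (<⇒≤ (toℕ<n δ)) (far-from-rotations i (j∉ ∘ there)))
      cheaper : hubCost i′ s ≤ hubPot i s
      cheaper = ⊓-glb (≤-trans (m≤m+n _ _) (hubCost-rotate i s (shift δ) d≤σ)) (<⇒≤ (hubCost<Cap i′ s))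
      cheaper′ : hubCost i′ s < hubPot i s + suc (toℕ r)
      cheaper′ = ≤-trans (s≤s (≤-trans cheaper (m≤m+n _ (toℕ r)))) (≤-reflexive (sym (+-suc _ (toℕ r))))

module Strategy (m₀ L₀ c₀ : ℕ) (3m≤c′ : 3 * suc m₀ ≤ suc c₀) (t₀ : ℕ) (2t<m : suc t₀ + suc t₀ < suc m₀) where

  open Construction m₀ L₀ c₀

  t K : ℕ
  t = suc t₀
  K = t + t

  open Reply m₀ L₀ c₀ K 2t<m

  open DecMembership (_≟ᶠ_ {m}) using (_∉?_)

  candidates : Fin n → List (Fin n)
  candidates a = map (index ∘ reply (vertex a)) (allFin K)

  candidates-unique : ∀ a → Unique (candidates a)
  candidates-unique a = map⁺ (reply-injective (vertex a) ∘ index-injective) (allFin⁺ K)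

  length-candidates : ∀ a → length (candidates a) ≡ K
  length-candidates a = trans (length-map _ (allFin K)) (length-tabulate (λ δ → δ))

  strategy : StrategyB n
  strategy h a = firstFree _≟ᶠ_ (a ∷ claimed h) (candidates a) (index (reply (vertex a) zero))

  strategy-∈-candidates : ∀ h a → strategy h a ∈ candidates a
  strategy-∈-candidates h a = firstFree-∈ _≟ᶠ_ (a ∷ claimed h) (∈-map⁺ _ (∈-allFin zero))

  replies-are-candidates : ∀ as → All (λ (a , b) → b ∈ candidates a) (play strategy as)
  replies-are-candidates []       = []
  replies-are-candidates (a ∷ as) = strategy-∈-candidates (play strategy as) a ∷ replies-are-candidates as

  strategy-fresh : ∀ a as → length as < t → strategy (play strategy as) a ∉ a ∷ claimed (play strategy as)
  strategy-fresh a as as<t = firstFree-∉ _≟ᶠ_ (a ∷ claimed h) _ (candidates-unique a)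
                                         (subst (length (a ∷ claimed h) <_) (sym (length-candidates a)) used<K)
    where
      h = play strategy as
      used<K : length (a ∷ claimed h) < K
      used<K = begin
        suc (suc (length (claimed h)))      ≡⟨ cong (λ x → 2 + x) (length-claimed strategy as) ⟩
        suc (suc (length as + length as))   ≡⟨ cong suc (+-suc (length as) (length as)) ⟨
        suc (length as) + suc (length as)   ≤⟨ +-mono-≤ as<t as<t ⟩
        K                                   ∎
        where open ≤-Reasoning

  spoiledBy : History n → List (Fin m)
  spoiledBy R = concatMap (spoiled ∘ vertex) (claimedA R)

  length-spoiledBy : ∀ R → length R ≤ t → length (spoiledBy R) ≤ t * suc K
  length-spoiledBy R R≤t = ≤-trans (length-concatMap≤ (spoiled ∘ vertex) (length-spoiled ∘ vertex) (claimedA R))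
                                   (*-monoˡ-≤ (suc K) (≤-trans (≤-reflexive (length-map proj₁ R)) R≤t))

  tail-controlled : ∀ r R → All (λ (a , b) → b ∈ candidates a) (r ∷ R) →
    ∀ j P → j ∉ spoiledBy (r ∷ R) → Controls G (claimedB (r ∷ R)) (claimedA (r ∷ R)) (index (tail j P))
  tail-controlled r R replies j P j∉ = Dominated⇒Controls Ψ≤dist r R (All.tabulate dominated)
    where
      open Potential m₀ L₀ c₀ 3m≤c′ j P using (Ψ; Ψ≤dist)
      open Domination m₀ L₀ c₀ 3m≤c′ K 2t<m j P using (reply-dominates)
      dominated : ∀ {ab} → ab ∈ r ∷ R → Dominated G (index (tail j P)) Ψ ab
      dominated {a , b} ab∈ with ∈-map⁻ _ (All.lookup replies ab∈)
      ... | δ , _ , refl =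
        reply-dominates (vertex a) δ (j∉ ∘ ∈-concatMap⁺ (spoiled ∘ vertex) ∘ lose (∈-map⁺ proj₁ ab∈))

  unspoiled : History n → List (Fin m)
  unspoiled R = filter (_∉? spoiledBy R) (allFin m)

  controlled : History n → List (Fin n)
  controlled R = cartesianProductWith (λ j P → index (tail j P)) (unspoiled R) (allFin L)

  controlled-unique : ∀ R → Unique (controlled R)
  controlled-unique R =
    cartesianProductWith⁺ _ tail-injective (filter⁺ (_∉? spoiledBy R) (allFin⁺ m)) (allFin⁺ L)
    where
      tail-injective : ∀ {j j′ P P′} → index (tail j P) ≡ index (tail j′ P′) → j ≡ j′ × P ≡ P′
      tail-injective e with index-injective e
      ... | refl = refl , refl

  length-controlled : ∀ R → length R ≤ t → (m ∸ t * suc K) * L ≤ length (controlled R)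
  length-controlled R R≤t = begin
    (m ∸ t * suc K) * L                              ≤⟨ *-monoˡ-≤ L (∸-monoʳ-≤ m (length-spoiledBy R R≤t)) ⟩
    (m ∸ length (spoiledBy R)) * L
      ≡⟨ cong (λ x → (x ∸ length (spoiledBy R)) * L) (length-tabulate (λ j → j)) ⟨
    (length (allFin m) ∸ length (spoiledBy R)) * L   ≤⟨ *-monoˡ-≤ L (length-filter-∉ _≟ᶠ_ (spoiledBy R) (allFin⁺ m)) ⟩
    length (unspoiled R) * L                         ≡⟨ cong (length (unspoiled R) *_) (length-tabulate (λ P → P)) ⟨
    length (unspoiled R) * length (allFin L)         ≡⟨ length-cartesianProductWith _ (unspoiled R) (allFin L) ⟨
    length (controlled R)                            ∎
    where open ≤-Reasoning

  controls-controlled : ∀ r R → All (λ (a , b) → b ∈ candidates a) (r ∷ R) →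
    All (Controls G (claimedB (r ∷ R)) (claimedA (r ∷ R))) (controlled (r ∷ R))
  controls-controlled r R replies = All.tabulate λ v∈ →
    let j , P , j∈ , _ , v≡ = ∈-cartesianProductWith⁻ _ (unspoiled (r ∷ R)) (allFin L) v∈
    in subst (Controls _ _ _) (sym v≡)
             (tail-controlled r R replies j P (proj₂ (∈-filter⁻ (_∉? spoiledBy (r ∷ R)) {xs = allFin m} j∈)))

  guarantees : ∀ ε → (∀ k → (m ∸ t * suc K) * L ≤ k → (1ℚ -ℚ ε) *ℚ (ℤ.+ n /ℚ 1) ≤ℚ ℤ.+ k /ℚ 1) →
               Guarantees G t ε strategy
  -- B avoids every claimed vertex.
  guarantees ε fraction a as a∷as≤t _ =
    fresh ∘ there , fresh ∘ here , controlled R , controlled-unique R ,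
    controls-controlled _ _ (replies-are-candidates (a ∷ as)) ,
    fraction _ (length-controlled R (≤-trans (≤-reflexive (length-play strategy (a ∷ as))) a∷as≤t))
    where
      R = play strategy (a ∷ as)
      fresh = strategy-fresh a as a∷as≤t

-- Choice of the parameters

size-bound : ∀ d B Y L R′ → d * B ≤ Y → d * suc (B + Y) * R′ ≤ L →
  d * (suc (B + Y) * (L + R′)) ≤ suc d * (suc Y * L)
size-bound d B Y L R′ dB≤Y dmR′≤L = begin
  d * (suc (B + Y) * (L + R′))                       ≡⟨ expand d B Y L R′ ⟩
  d * B * L + d * suc (B + Y) * R′ + d * (suc Y * L)
    ≤⟨ +-monoˡ-≤ (d * (suc Y * L)) (+-mono-≤ (*-monoˡ-≤ L dB≤Y) dmR′≤L) ⟩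
  Y * L + L + d * (suc Y * L)                        ≡⟨ collect d Y L ⟩
  suc d * (suc Y * L)                                ∎
  where
    open ≤-Reasoning
    expand : ∀ d B Y L R′ → d * (suc (B + Y) * (L + R′)) ≡ d * B * L + d * suc (B + Y) * R′ + d * (suc Y * L)
    expand = solve-∀
    collect : ∀ d Y L → Y * L + L + d * (suc Y * L) ≡ suc d * (suc Y * L)
    collect = solve-∀

-- B bounds the number of spoiled columns and m R′ is the number of vertices off the tails.
-- Since m ∸ B = 1 + Y with d B ≤ Y and d m R′ < L, size-bound gives d n ≤ (1 + d) (m ∸ B) L.
module Parameters (t₀ d : ℕ) where

  K B Y m₀ c₀ R′ L₀ : ℕ
  K  = suc t₀ + suc t₀
  B  = suc t₀ * suc K
  Y  = d * B + K
  m₀ = B + Y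
  c₀ = 3 * suc m₀
  R′ = suc m₀ + (suc m₀ + (suc m₀ + suc m₀ * suc c₀))
  L₀ = d * suc m₀ * R′

  2t<m : K < suc m₀
  2t<m = s≤s (≤-trans (m≤n+m K (B + d * B)) (≤-reflexive (+-assoc B (d * B) K)))

  open Construction m₀ L₀ c₀ public using (n; G; maxDegree3)
  open Strategy m₀ L₀ c₀ (n≤1+n _) t₀ 2t<m public using (strategy; guarantees)

  2t≤n : 2 * suc t₀ ≤ n
  2t≤n = ≤-trans (≤-reflexive (cong (suc t₀ +_) (+-identityʳ (suc t₀)))) (≤-trans (<⇒≤ 2t<m) (m≤m*n (suc m₀) _))

  d*n≤[1+d]*k : ∀ {k} → (suc m₀ ∸ suc t₀ * suc K) * suc L₀ ≤ k → d * n ≤ suc d * k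
  d*n≤[1+d]*k {k} k≥ = begin
    d * n                                 ≤⟨ size-bound d B Y (suc L₀) R′ (m≤m+n (d * B) K) (n≤1+n L₀) ⟩
    suc d * (suc Y * suc L₀)              ≡⟨ cong (λ x → suc d * (x * suc L₀)) m∸B≡1+Y ⟨
    suc d * ((suc m₀ ∸ B) * suc L₀)       ≤⟨ *-monoʳ-≤ (suc d) k≥ ⟩
    suc d * k                             ∎
    where
      open ≤-Reasoning
      m∸B≡1+Y : suc m₀ ∸ B ≡ suc Y
      m∸B≡1+Y = trans (+-∸-assoc 1 (m≤m+n B Y)) (cong suc (m+n∸m≡n B Y))

lemma3 : (t : ℕ) → 1 ≤ t → (ε : ℚ) → 0ℚ <ℚ ε →
    Σ ℕ λ n → Σ (Graph n) λ G → MaxDegree3 G × (2 * t ≤ n)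
    × ∃ λ (σ : StrategyB n) → Guarantees G t ε σ
lemma3 (suc t₀) _ ε ε>0 =
  n , G , maxDegree3 , 2t≤n , strategy , guarantees ε λ k k≥ → [1-ε]*n≤k ε ε>0 n k (d*n≤[1+d]*k k≥)
  where open Parameters t₀ (ℚ.denominator-1 ε)
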